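{- Let $r\ge3$ and $1<s\le r$ be integers, let $a_1,\dots,a_r\in\Omega$ be defined recursively by $a_1=(a_r,\mathrm{id})\sigma$, $a_i=(\mathrm{id},a_{i-1})$ for $2\le i\le s-1$, $a_s=(\mathrm{id},a_{s-1})\sigma$, $a_i=(a_{i-1},\mathrm{id})$ for $s+1\le i\le r$, and let $G$ be the closed subgroup of $\Omega$ topologically generated by $a_1,\dots,a_r$. Then for every $g\in G$, the automorphism $(g,g)$ belongs to $G$.
   Context: $T$ is the regular rooted binary tree whose vertices are finite words over $\{0,1\}$; $\Omega=\mathrm{Aut}(T)$ with its profinite topology; automorphisms act on the right and $\gamma\gamma'$ means first $\gamma$ then $\gamma'$. Every $\gamma\in\Omega$ is written uniquely as $(\gamma_0,\gamma_1)\tau$ with $\tau\in\{\mathrm{id},\sigma\}$, meaning $(xv)\gamma=(x)\tau\,(v)\gamma_x$ for a letter $x$ and word $v$; $\sigma=(\mathrm{id},\mathrm{id})\sigma$ swaps the first letter; $(g,g)$ abbreviates $(g,g)\mathrm{id}$. Multiplication: $(\gamma_0,\gamma_1)\tau\cdot(\gamma_0',\gamma_1')\tau'=(\gamma_0\gamma'_{(0)\tau},\gamma_1\gamma'_{(1)\tau})\tau\tau'$. -}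

module Defs where

open import Data.Bool using (Bool; true; false; if_then_else_; _xor_; _∨_)
open import Data.Nat using (ℕ; zero; suc; pred; _<_; _≡ᵇ_; _≤ᵇ_)
open import Data.Fin using (Fin; toℕ)
open import Data.List using (List; []; _∷_; length)
open import Data.Product using (_×_; _,_; ∃)
open import Relation.Binary.PropositionalEquality using (_≡_)

-- Automorphisms of the binary tree T, represented by their portraits:
-- γ v = true  iff  the section of γ at vertex v has root permutation σ.
-- Letters: false = 0, true = 1.  Every automorphism has a unique portrait.
Aut : Set
Aut = List Bool → Bool

one : Aut
one _ = false

section : Aut → Bool → Aut
section γ x v = γ (x ∷ v)

act : Aut → List Bool → List Bool
act γ [] = []
act γ (x ∷ v) = (x xor γ []) ∷ act (section γ x) v

-- product γγ' : first γ then γ'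
_·_ : Aut → Aut → Aut
(γ · γ') v = γ v xor γ' (act γ v)

-- inverse:  ((γ₀,γ₁)τ)⁻¹ = (γ_{(0)τ}⁻¹ , γ_{(1)τ}⁻¹) τ
inv : Aut → Aut
inv γ [] = γ []
inv γ (x ∷ v) = inv (section γ (x xor γ [])) v

diag : Aut → Aut
diag g [] = false
diag g (x ∷ v) = g v

-- Generators a_i (1 ≤ i ≤ r) for parameters r, s:
--  a_1 = (a_r, id)σ ; a_i = (id, a_{i-1}) for 2 ≤ i ≤ s-1 ;
--  a_s = (id, a_{s-1})σ ; a_i = (a_{i-1}, id) for s+1 ≤ i ≤ r.
-- (indices outside 1..r give the identity; they are never used)
gen : ℕ → ℕ → ℕ → Aut
gen r s i [] = (i ≡ᵇ 1) ∨ (i ≡ᵇ s)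
gen r s zero (x ∷ v) = false
gen r s (suc i) (x ∷ v) =
  if suc i ≡ᵇ 1 then (if x then false else gen r s r v)
  else if suc i ≤ᵇ s then (if x then gen r s i v else false)
  else if suc i ≤ᵇ r then (if x then false else gen r s i v)
  else false

a : (r s : ℕ) → Fin r → Aut
a r s k = gen r s (suc (toℕ k))

evalWord : (r s : ℕ) → List (Fin r × Bool) → Aut
evalWord r s [] = one
evalWord r s ((k , false) ∷ w) = a r s k · evalWord r s w
evalWord r s ((k , true) ∷ w) = inv (a r s k) · evalWord r s w

-- γ and δ agree on all vertices of length < n (i.e. act identically on levels ≤ n)
AgreeBelow : ℕ → Aut → Aut → Set
AgreeBelow n γ δ = ∀ v → length v < n → γ v ≡ δ v

-- g ∈ G = closure in the profinite topology of the subgroup ⟨a_1,…,a_r⟩: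
-- every basic neighbourhood of g meets ⟨a_1,…,a_r⟩.
InG : (r s : ℕ) → Aut → Set
InG r s g = ∀ (n : ℕ) → ∃ λ (w : List (Fin r × Bool)) → AgreeBelow n g (evalWord r s w)

-- The map g ↦ (g,g) is a homomorphism Ω → Ω, and (g,g) agrees with (h,h) on
-- every level on which g agrees with h; so it suffices that each (aᵢ,aᵢ) is a
-- word in the generators. Squaring a first-level swap gives a₁² = (a_r,a_r) and
-- a_s² = (a_{s-1},a_{s-1}). Conjugating by a swap moves a section to the other
-- subtree, so for the non-swapping generators a_{i+1} = (id,aᵢ) (with i+1 < s)
-- and a_{i+1} = (aᵢ,id) (with s ≤ i) the words a_{i+1} a₁⁻¹ a_{i+1} a₁ and
-- a_{i+1} a_s⁻¹ a_{i+1} a_s both equal (aᵢ,aᵢ).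
module Submission where

open import Defs
open import Algebra.Bundles using (Group)
open import Algebra.Structures using (IsGroup)
open import Data.Bool using (Bool; true; false; _xor_; if_then_else_)
open import Data.Bool.Properties using (xor-assoc; xor-same; xor-identityʳ)
open import Data.Fin using (fromℕ<)
open import Data.Fin.Properties using (toℕ-fromℕ<; toℕ<n)
open import Data.List using ([]; _∷_; _++_)
open import Data.Nat using (ℕ; suc; pred; _≤_; _<_; s≤s; z≤n)
open import Data.Nat.Properties
  using (_≟_; _≤?_; ≤-refl; ≤-reflexive; ≤-trans; <⇒≤; <⇒≢; >⇒≢; <⇒≱; ≤∧≢⇒<; <-cmp)
open import Data.Product using (_,_; ∃)
open import Level using (0ℓ)
open import Relation.Binary.Definitions using (tri<; tri≈; tri>)
open import Relation.Binary.PropositionalEquality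
  using (_≡_; _≗_; refl; sym; trans; cong; cong₂; subst; module ≡-Reasoning)
open import Relation.Binary.Structures using (IsEquivalence)
open import Relation.Nullary using (yes; no)
open import Relation.Nullary.Decidable using (dec-true; dec-false)

-- Equality of portraits, wrapped in a record so that Agda does not unfold it to
-- a Π-type and can still infer the automorphisms it relates.
infix 4 _≈_
record _≈_ (γ δ : Aut) : Set where
  constructor pointwise
  field at : γ ≗ δ
open _≈_ public

≈-isEquivalence : IsEquivalence _≈_
≈-isEquivalence = record
  { refl  = pointwise λ _ → refl
  ; sym   = λ γ≈δ → pointwise λ v → sym (at γ≈δ v)
  ; trans = λ γ≈δ δ≈ε → pointwise λ v → trans (at γ≈δ v) (at δ≈ε v)
  }

section-cong : ∀ {γ δ} → γ ≈ δ → ∀ x → section γ x ≈ section δ x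
section-cong γ≈δ x = pointwise λ v → at γ≈δ (x ∷ v)

act-cong : ∀ {γ δ} → γ ≈ δ → ∀ v → act γ v ≡ act δ v
act-cong γ≈δ []      = refl
act-cong γ≈δ (x ∷ v) =
  cong₂ _∷_ (cong (x xor_) (at γ≈δ [])) (act-cong (section-cong γ≈δ x) v)

act-· : ∀ γ δ v → act (γ · δ) v ≡ act δ (act γ v)
act-· γ δ []      = refl
act-· γ δ (x ∷ v) =
  cong₂ _∷_ (sym (xor-assoc x (γ []) (δ []))) (act-· (section γ x) (section δ (x xor γ [])) v)

act-one : ∀ v → act one v ≡ v
act-one []      = refl
act-one (x ∷ v) = cong₂ _∷_ (xor-identityʳ x) (act-one v)

xor-cancelʳ : ∀ x y → (x xor y) xor y ≡ x
xor-cancelʳ x y = begin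
  (x xor y) xor y ≡⟨ xor-assoc x y y ⟩
  x xor (y xor y) ≡⟨ cong (x xor_) (xor-same y) ⟩
  x xor false     ≡⟨ xor-identityʳ x ⟩
  x               ∎
  where open ≡-Reasoning

·-cong : ∀ {γ γ′ δ δ′} → γ ≈ γ′ → δ ≈ δ′ → γ · δ ≈ γ′ · δ′
·-cong {γ} {γ′} {δ} γ≈γ′ δ≈δ′ = pointwise λ v →
  cong₂ _xor_ (at γ≈γ′ v) (trans (cong δ (act-cong γ≈γ′ v)) (at δ≈δ′ (act γ′ v)))

·-congˡ : ∀ γ {δ δ′} → δ ≈ δ′ → γ · δ ≈ γ · δ′
·-congˡ γ δ≈δ′ = pointwise λ v → cong (γ v xor_) (at δ≈δ′ (act γ v))

·-assoc : ∀ γ δ ε → (γ · δ) · ε ≈ γ · (δ · ε)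
·-assoc γ δ ε = pointwise λ v →
  trans (cong ((γ v xor δ (act γ v)) xor_) (cong ε (act-· γ δ v))) (xor-assoc (γ v) _ _)

·-identityˡ : ∀ γ → one · γ ≈ γ
·-identityˡ γ = pointwise λ v → cong γ (act-one v)

·-identityʳ : ∀ γ → γ · one ≈ γ
·-identityʳ γ = pointwise λ v → xor-identityʳ (γ v)

·-inverseˡ : ∀ γ → inv γ · γ ≈ one
·-inverseˡ γ = pointwise (go γ)
  where
  go : ∀ γ v → (inv γ · γ) v ≡ false
  go γ []      = xor-same (γ [])
  go γ (x ∷ v) = go (section γ (x xor γ [])) v

·-inverseʳ : ∀ γ → γ · inv γ ≈ one
·-inverseʳ γ = pointwise (go γ)
  where
  go : ∀ γ v → (γ · inv γ) v ≡ false
  go γ []      = xor-same (γ [])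
  go γ (x ∷ v) rewrite xor-cancelʳ x (γ []) = go (section γ x) v

inv-cong : ∀ {γ δ} → γ ≈ δ → inv γ ≈ inv δ
inv-cong γ≈δ = pointwise (go γ≈δ)
  where
  go : ∀ {γ δ} → γ ≈ δ → ∀ v → inv γ v ≡ inv δ v
  go γ≈δ []              = at γ≈δ []
  go {δ = δ} γ≈δ (x ∷ v) rewrite at γ≈δ [] = go (section-cong γ≈δ (x xor δ [])) v

·-one-isGroup : IsGroup _≈_ _·_ one inv
·-one-isGroup = record
  { isMonoid = record
    { isSemigroup = record
      { isMagma = record { isEquivalence = ≈-isEquivalence ; ∙-cong = ·-cong }
      ; assoc   = ·-assoc
      }
    ; identity = ·-identityˡ , ·-identityʳ
    }
  ; inverse = ·-inverseˡ , ·-inverseʳ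
  ; ⁻¹-cong = inv-cong
  }

·-one-group : Group 0ℓ 0ℓ
·-one-group = record { isGroup = ·-one-isGroup }

open Group ·-one-group using (setoid)
  renaming (refl to ≈-refl; sym to ≈-sym; trans to ≈-trans)
open import Algebra.Properties.Group ·-one-group using (ε⁻¹≈ε; ⁻¹-involutive; ⁻¹-anti-homo-∙)
open import Relation.Binary.Reasoning.Setoid setoid

conjugate-by-one : ∀ γ → inv one · (γ · one) ≈ γ
conjugate-by-one γ = begin
  inv one · (γ · one) ≈⟨ ·-cong ε⁻¹≈ε (·-identityʳ γ) ⟩
  one · γ             ≈⟨ ·-identityˡ γ ⟩
  γ                   ∎

conjugate-of-one : ∀ γ → inv γ · (one · γ) ≈ one
conjugate-of-one γ = begin
  inv γ · (one · γ) ≈⟨ ·-congˡ (inv γ) (·-identityˡ γ) ⟩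
  inv γ · γ         ≈⟨ ·-inverseˡ γ ⟩
  one               ∎

-- The paper's (γ₀,γ₁)τ, with τ = true standing for σ.
infix 25 ⟪_,_⟫_
⟪_,_⟫_ : Aut → Aut → Bool → Aut
(⟪ γ₀ , γ₁ ⟫ τ) []      = τ
(⟪ γ₀ , γ₁ ⟫ τ) (x ∷ v) = if x then γ₁ v else γ₀ v

⟪⟫-cong : ∀ {γ₀ γ₁ δ₀ δ₁} τ → γ₀ ≈ δ₀ → γ₁ ≈ δ₁ → ⟪ γ₀ , γ₁ ⟫ τ ≈ ⟪ δ₀ , δ₁ ⟫ τ
⟪⟫-cong τ γ₀≈δ₀ γ₁≈δ₁ = pointwise λ
  { [] → refl ; (false ∷ v) → at γ₀≈δ₀ v ; (true ∷ v) → at γ₁≈δ₁ v }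

⟪⟫-·-⟪⟫ : ∀ {γ₀ γ₁ τ δ₀ δ₁ τ′} → ⟪ γ₀ , γ₁ ⟫ τ · ⟪ δ₀ , δ₁ ⟫ τ′ ≈
  ⟪ γ₀ · (if τ then δ₁ else δ₀) , γ₁ · (if τ then δ₀ else δ₁) ⟫ (τ xor τ′)
⟪⟫-·-⟪⟫ {τ = false} = pointwise λ { [] → refl ; (false ∷ v) → refl ; (true ∷ v) → refl }
⟪⟫-·-⟪⟫ {τ = true}  = pointwise λ { [] → refl ; (false ∷ v) → refl ; (true ∷ v) → refl }

inv-⟪⟫ : ∀ {γ₀ γ₁ τ} →
  inv (⟪ γ₀ , γ₁ ⟫ τ) ≈ ⟪ inv (if τ then γ₁ else γ₀) , inv (if τ then γ₀ else γ₁) ⟫ τ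
inv-⟪⟫ {τ = false} = pointwise λ { [] → refl ; (false ∷ v) → refl ; (true ∷ v) → refl }
inv-⟪⟫ {τ = true}  = pointwise λ { [] → refl ; (false ∷ v) → refl ; (true ∷ v) → refl }

conjugate-by-swap : ∀ γ₀ γ₁ δ₀ δ₁ →
  inv (⟪ γ₀ , γ₁ ⟫ true) · (⟪ δ₀ , δ₁ ⟫ false · ⟪ γ₀ , γ₁ ⟫ true) ≈
  ⟪ inv γ₁ · (δ₁ · γ₁) , inv γ₀ · (δ₀ · γ₀) ⟫ false
conjugate-by-swap γ₀ γ₁ δ₀ δ₁ = begin
  inv (⟪ γ₀ , γ₁ ⟫ true) · (⟪ δ₀ , δ₁ ⟫ false · ⟪ γ₀ , γ₁ ⟫ true)
    ≈⟨ ·-cong inv-⟪⟫ ⟪⟫-·-⟪⟫ ⟩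
  ⟪ inv γ₁ , inv γ₀ ⟫ true · ⟪ δ₀ · γ₀ , δ₁ · γ₁ ⟫ true
    ≈⟨ ⟪⟫-·-⟪⟫ ⟩
  ⟪ inv γ₁ · (δ₁ · γ₁) , inv γ₀ · (δ₀ · γ₀) ⟫ false
    ∎

diag-⟪⟫ : ∀ γ → diag γ ≈ ⟪ γ , γ ⟫ false
diag-⟪⟫ γ = pointwise λ { [] → refl ; (false ∷ v) → refl ; (true ∷ v) → refl }

diag-one : diag one ≈ one
diag-one = pointwise λ { [] → refl ; (x ∷ v) → refl }

diag-· : ∀ γ δ → diag (γ · δ) ≈ diag γ · diag δ
diag-· γ δ = pointwise λ { [] → refl ; (x ∷ v) → refl }

diag-inv : ∀ γ → diag (inv γ) ≈ inv (diag γ)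
diag-inv γ = pointwise λ { [] → refl ; (x ∷ v) → refl }

diag-agreeBelow : ∀ {n γ δ} → AgreeBelow n γ δ → AgreeBelow n (diag γ) (diag δ)
diag-agreeBelow γ≈δ []      _      = refl
diag-agreeBelow γ≈δ (x ∷ v) |xv|<n = γ≈δ v (<⇒≤ |xv|<n)

square≈diag₀ : ∀ {X γ} → X ≈ ⟪ γ , one ⟫ true → X · X ≈ diag γ
square≈diag₀ {X} {γ} X≈ = begin
  X · X                               ≈⟨ ·-cong X≈ X≈ ⟩
  ⟪ γ , one ⟫ true · ⟪ γ , one ⟫ true ≈⟨ ⟪⟫-·-⟪⟫ ⟩
  ⟪ γ · one , one · γ ⟫ false         ≈⟨ ⟪⟫-cong false (·-identityʳ γ) (·-identityˡ γ) ⟩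
  ⟪ γ , γ ⟫ false                     ≈⟨ diag-⟪⟫ γ ⟨
  diag γ                              ∎

square≈diag₁ : ∀ {X γ} → X ≈ ⟪ one , γ ⟫ true → X · X ≈ diag γ
square≈diag₁ {X} {γ} X≈ = begin
  X · X                               ≈⟨ ·-cong X≈ X≈ ⟩
  ⟪ one , γ ⟫ true · ⟪ one , γ ⟫ true ≈⟨ ⟪⟫-·-⟪⟫ ⟩
  ⟪ one · γ , γ · one ⟫ false         ≈⟨ ⟪⟫-cong false (·-identityˡ γ) (·-identityʳ γ) ⟩
  ⟪ γ , γ ⟫ false                     ≈⟨ diag-⟪⟫ γ ⟨
  diag γ                              ∎

·conjugate≈diag₀ : ∀ {X Y ρ γ} → X ≈ ⟪ one , ρ ⟫ true → Y ≈ ⟪ γ , one ⟫ false →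
  Y · (inv X · (Y · X)) ≈ diag γ
·conjugate≈diag₀ {X} {Y} {ρ} {γ} X≈ Y≈ = begin
  Y · (inv X · (Y · X))
    ≈⟨ ·-cong Y≈ (·-cong (inv-cong X≈) (·-cong Y≈ X≈)) ⟩
  ⟪ γ , one ⟫ false · (inv (⟪ one , ρ ⟫ true) · (⟪ γ , one ⟫ false · ⟪ one , ρ ⟫ true))
    ≈⟨ ·-congˡ (⟪ γ , one ⟫ false) (conjugate-by-swap one ρ γ one) ⟩
  ⟪ γ , one ⟫ false · ⟪ inv ρ · (one · ρ) , inv one · (γ · one) ⟫ false
    ≈⟨ ·-congˡ (⟪ γ , one ⟫ false) (⟪⟫-cong false (conjugate-of-one ρ) (conjugate-by-one γ)) ⟩
  ⟪ γ , one ⟫ false · ⟪ one , γ ⟫ false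
    ≈⟨ ⟪⟫-·-⟪⟫ ⟩
  ⟪ γ · one , one · γ ⟫ false
    ≈⟨ ⟪⟫-cong false (·-identityʳ γ) (·-identityˡ γ) ⟩
  ⟪ γ , γ ⟫ false
    ≈⟨ diag-⟪⟫ γ ⟨
  diag γ
    ∎

·conjugate≈diag₁ : ∀ {X Y ρ γ} → X ≈ ⟪ ρ , one ⟫ true → Y ≈ ⟪ one , γ ⟫ false →
  Y · (inv X · (Y · X)) ≈ diag γ
·conjugate≈diag₁ {X} {Y} {ρ} {γ} X≈ Y≈ = begin
  Y · (inv X · (Y · X))
    ≈⟨ ·-cong Y≈ (·-cong (inv-cong X≈) (·-cong Y≈ X≈)) ⟩
  ⟪ one , γ ⟫ false · (inv (⟪ ρ , one ⟫ true) · (⟪ one , γ ⟫ false · ⟪ ρ , one ⟫ true))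
    ≈⟨ ·-congˡ (⟪ one , γ ⟫ false) (conjugate-by-swap ρ one one γ) ⟩
  ⟪ one , γ ⟫ false · ⟪ inv one · (γ · one) , inv ρ · (one · ρ) ⟫ false
    ≈⟨ ·-congˡ (⟪ one , γ ⟫ false) (⟪⟫-cong false (conjugate-by-one γ) (conjugate-of-one ρ)) ⟩
  ⟪ one , γ ⟫ false · ⟪ γ , one ⟫ false
    ≈⟨ ⟪⟫-·-⟪⟫ ⟩
  ⟪ one · γ , γ · one ⟫ false
    ≈⟨ ⟪⟫-cong false (·-identityˡ γ) (·-identityʳ γ) ⟩
  ⟪ γ , γ ⟫ false
    ≈⟨ diag-⟪⟫ γ ⟨
  diag γ
    ∎

gen-1 : ∀ r s → gen r s 1 ≈ ⟪ gen r s r , one ⟫ true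
gen-1 r s = pointwise λ { [] → refl ; (x ∷ v) → refl }

gen-suc-≡s : ∀ {r s i} → 1 ≤ i → suc i ≡ s → gen r s (suc i) ≈ ⟪ one , gen r s i ⟫ true
gen-suc-≡s {r} {s} {suc t} _ i+1≡s = pointwise go
  where
  go : ∀ v → gen r s (suc (suc t)) v ≡ (⟪ one , gen r s (suc t) ⟫ true) v
  go []      = dec-true (suc (suc t) ≟ s) i+1≡s
  go (x ∷ v) rewrite dec-true (suc (suc t) ≤? s) (≤-reflexive i+1≡s) = refl

gen-s : ∀ {r s} → 1 < s → gen r s s ≈ ⟪ one , gen r s (pred s) ⟫ true
gen-s {s = suc i} (s≤s 1≤i) = gen-suc-≡s 1≤i refl

gen-suc-<s : ∀ {r s i} → 1 ≤ i → suc i < s → gen r s (suc i) ≈ ⟪ one , gen r s i ⟫ false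
gen-suc-<s {r} {s} {suc t} _ i+1<s = pointwise go
  where
  go : ∀ v → gen r s (suc (suc t)) v ≡ (⟪ one , gen r s (suc t) ⟫ false) v
  go []      = dec-false (suc (suc t) ≟ s) (<⇒≢ i+1<s)
  go (x ∷ v) rewrite dec-true (suc (suc t) ≤? s) (<⇒≤ i+1<s) = refl

gen-suc->s : ∀ {r s i} → 1 ≤ i → s < suc i → suc i ≤ r →
  gen r s (suc i) ≈ ⟪ gen r s i , one ⟫ false
gen-suc->s {r} {s} {suc t} _ s<i+1 i+1≤r = pointwise go
  where
  go : ∀ v → gen r s (suc (suc t)) v ≡ (⟪ gen r s (suc t) , one ⟫ false) v
  go []      = dec-false (suc (suc t) ≟ s) (>⇒≢ s<i+1)
  go (x ∷ v)
    rewrite dec-false (suc (suc t) ≤? s) (<⇒≱ s<i+1) | dec-true (suc (suc t) ≤? r) i+1≤r = refl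

module _ (r s : ℕ) where

  Generated : Aut → Set
  Generated γ = ∃ λ w → evalWord r s w ≈ γ

  generated-resp : ∀ {γ δ} → γ ≈ δ → Generated γ → Generated δ
  generated-resp γ≈δ (w , w≈γ) = w , ≈-trans w≈γ γ≈δ

  generated-one : Generated one
  generated-one = [] , ≈-refl

  evalWord-++ : ∀ u w → evalWord r s (u ++ w) ≈ evalWord r s u · evalWord r s w
  evalWord-++ [] w = ≈-sym (·-identityˡ (evalWord r s w))
  evalWord-++ ((k , false) ∷ u) w = ≈-trans (·-congˡ (a r s k) (evalWord-++ u w))
    (≈-sym (·-assoc (a r s k) (evalWord r s u) (evalWord r s w)))
  evalWord-++ ((k , true) ∷ u) w = ≈-trans (·-congˡ (inv (a r s k)) (evalWord-++ u w))
    (≈-sym (·-assoc (inv (a r s k)) (evalWord r s u) (evalWord r s w)))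

  generated-· : ∀ {γ δ} → Generated γ → Generated δ → Generated (γ · δ)
  generated-· (u , u≈γ) (w , w≈δ) = u ++ w , ≈-trans (evalWord-++ u w) (·-cong u≈γ w≈δ)

  generated-a : ∀ k → Generated (a r s k)
  generated-a k = (k , false) ∷ [] , ·-identityʳ (a r s k)

  generated-a⁻¹ : ∀ k → Generated (inv (a r s k))
  generated-a⁻¹ k = (k , true) ∷ [] , ·-identityʳ (inv (a r s k))

  generated-inv-evalWord : ∀ w → Generated (inv (evalWord r s w))
  generated-inv-evalWord [] = generated-resp (≈-sym ε⁻¹≈ε) generated-one
  generated-inv-evalWord ((k , false) ∷ w) =
    generated-resp (≈-sym (⁻¹-anti-homo-∙ (a r s k) (evalWord r s w)))
      (generated-· (generated-inv-evalWord w) (generated-a⁻¹ k))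
  generated-inv-evalWord ((k , true) ∷ w) =
    generated-resp (≈-sym (⁻¹-anti-homo-∙ (inv (a r s k)) (evalWord r s w)))
      (generated-· (generated-inv-evalWord w)
        (generated-resp (≈-sym (⁻¹-involutive (a r s k))) (generated-a k)))

  generated-inv : ∀ {γ} → Generated γ → Generated (inv γ)
  generated-inv (w , w≈γ) = generated-resp (inv-cong w≈γ) (generated-inv-evalWord w)

  generated-·conjugate : ∀ {X Y} → Generated X → Generated Y →
    Generated (Y · (inv X · (Y · X)))
  generated-·conjugate X∈ Y∈ = generated-· Y∈ (generated-· (generated-inv X∈) (generated-· Y∈ X∈))

  generated-gen : ∀ {i} → 1 ≤ i → i ≤ r → Generated (gen r s i)
  generated-gen {suc i} _ i<r =
    subst (λ j → Generated (gen r s (suc j))) (toℕ-fromℕ< i<r) (generated-a (fromℕ< i<r))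

module _ {r s : ℕ} (1<s : 1 < s) (s≤r : s ≤ r) where

  private
    a₁∈ : Generated r s (gen r s 1)
    a₁∈ = generated-gen r s ≤-refl (≤-trans (<⇒≤ 1<s) s≤r)

    aₛ∈ : Generated r s (gen r s s)
    aₛ∈ = generated-gen r s (<⇒≤ 1<s) s≤r

  generated-diag-gen-<r : ∀ {i} → 1 ≤ i → i < r → Generated r s (diag (gen r s i))
  generated-diag-gen-<r {i} 1≤i i<r with <-cmp (suc i) s
  ... | tri< i+1<s _ _ =
    generated-resp r s (·conjugate≈diag₁ (gen-1 r s) (gen-suc-<s 1≤i i+1<s))
      (generated-·conjugate r s a₁∈ (generated-gen r s (s≤s z≤n) i<r))
  ... | tri≈ _ i+1≡s _ =
    generated-resp r s (square≈diag₁ (gen-suc-≡s 1≤i i+1≡s))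
      (generated-· r s (generated-gen r s (s≤s z≤n) i<r) (generated-gen r s (s≤s z≤n) i<r))
  ... | tri> _ _ s<i+1 =
    generated-resp r s (·conjugate≈diag₀ (gen-s 1<s) (gen-suc->s 1≤i s<i+1 i<r))
      (generated-·conjugate r s aₛ∈ (generated-gen r s (s≤s z≤n) i<r))

  generated-diag-gen : ∀ {i} → 1 ≤ i → i ≤ r → Generated r s (diag (gen r s i))
  generated-diag-gen {i} 1≤i i≤r with i ≟ r
  ... | yes i≡r =
    subst (λ j → Generated r s (diag (gen r s j))) (sym i≡r)
      (generated-resp r s (square≈diag₀ (gen-1 r s)) (generated-· r s a₁∈ a₁∈))
  ... | no i≢r = generated-diag-gen-<r 1≤i (≤∧≢⇒< i≤r i≢r)

  generated-diag : ∀ w → Generated r s (diag (evalWord r s w))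
  generated-diag [] = generated-resp r s (≈-sym diag-one) (generated-one r s)
  generated-diag ((k , false) ∷ w) =
    generated-resp r s (≈-sym (diag-· (a r s k) (evalWord r s w)))
      (generated-· r s (generated-diag-gen (s≤s z≤n) (toℕ<n k)) (generated-diag w))
  generated-diag ((k , true) ∷ w) =
    generated-resp r s (≈-sym (diag-· (inv (a r s k)) (evalWord r s w)))
      (generated-· r s
        (generated-resp r s (≈-sym (diag-inv (a r s k)))
          (generated-inv r s (generated-diag-gen (s≤s z≤n) (toℕ<n k))))
        (generated-diag w))

lemma4p6 : (r s : ℕ) → 3 ≤ r → 1 < s → s ≤ r →
    (g : Aut) → InG r s g → InG r s (diag g)
lemma4p6 r s _ 1<s s≤r _ g∈G n with g∈G n
... | w , g≈w with generated-diag 1<s s≤r w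
... | w′ , w′≈diag-w = w′ , λ v |v|<n →
  trans (diag-agreeBelow g≈w v |v|<n) (sym (at w′≈diag-w v))
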